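{- Let $G$ be either a dihedral group $D_{2n} = \langle a, b \mid a^n = b^2 = e,\ ab = ba^{ -1}\rangle$ with $n \geq 3$, or a dicyclic group $Q_{4n} = \langle a, b \mid a^{2n} = e,\ a^n = b^2,\ ab = ba^{ -1}\rangle$ with $n \geq 2$. Then $\kappa(\mathcal{P}(G)) \neq c\kappa(\mathcal{P}(G))$.
   Context: The power graph $\mathcal{P}(G)$ of a group $G$ is the simple undirected graph with vertex set $G$ in which two distinct vertices are adjacent if one of them is a positive power of the other. For a graph $\Gamma$, the vertex connectivity $\kappa(\Gamma)$ is the minimum number of vertices whose deletion either disconnects $\Gamma$ or reduces it to a trivial graph. A set $S$ of vertices is a cyclic vertex cutset if $\Gamma - S$ is disconnected and has at least two components each of which contains a cycle. The cyclic vertex connectivity $c\kappa(\Gamma)$ is the minimum cardinality of a cyclic vertex cutset of $\Gamma$, and is taken to be $\infty$ if no cyclic vertex cutset exists. -}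

module Defs where

open import Data.Nat using (ℕ; zero; suc; _+_; _*_; _∸_; _≤_)
open import Data.Nat.DivMod using (_%_; m%n<n)
open import Data.Fin using (Fin; toℕ; fromℕ<)
open import Data.Bool using (Bool; true; false)
open import Data.Product using (Σ; _×_; _,_)
open import Data.Sum using (_⊎_)
open import Data.List using (List; []; _∷_; _++_; length)
open import Data.List.Membership.Propositional using (_∉_)
open import Data.List.Relation.Unary.All using (All)
open import Data.List.Relation.Unary.Linked using (Linked)
open import Data.List.Relation.Unary.Unique.Propositional using (Unique)
open import Relation.Binary.PropositionalEquality using (_≡_; _≢_)
open import Relation.Nullary using (¬_)

-- Modular arithmetic on Fin m (the Fin argument only witnesses m ≠ 0)

modF : ∀ {m} → Fin m → ℕ → Fin m
modF {suc k} _ x = fromℕ< (m%n<n x (suc k))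

-- Dihedral group D_{2n}: (i , false) = a^i, (i , true) = a^i b,
-- with a^n = b^2 = e, b a^j = a^{-j} b.

D : ℕ → Set
D n = Fin n × Bool

mulD : (n : ℕ) → D n → D n → D n
mulD n (i , false) (j , false) = modF i (toℕ i + toℕ j) , false
mulD n (i , false) (j , true)  = modF i (toℕ i + toℕ j) , true
mulD n (i , true)  (j , false) = modF i (toℕ i + (n ∸ toℕ j)) , true
mulD n (i , true)  (j , true)  = modF i (toℕ i + (n ∸ toℕ j)) , false

-- Dicyclic group Q_{4n}: (i , false) = a^i, (i , true) = a^i b,
-- with a^{2n} = e, b^2 = a^n, b a^j = a^{-j} b.

Q : ℕ → Set
Q n = Fin (2 * n) × Bool

mulQ : (n : ℕ) → Q n → Q n → Q n
mulQ n (i , false) (j , false) = modF i (toℕ i + toℕ j) , false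
mulQ n (i , false) (j , true)  = modF i (toℕ i + toℕ j) , true
mulQ n (i , true)  (j , false) = modF i (toℕ i + (2 * n ∸ toℕ j)) , true
mulQ n (i , true)  (j , true)  = modF i (toℕ i + (2 * n ∸ toℕ j) + n) , false

-- pow _∙_ x k = x^(k+1)   (positive powers only)
pow : {V : Set} → (V → V → V) → V → ℕ → V
pow _∙_ x zero    = x
pow _∙_ x (suc k) = x ∙ pow _∙_ x k

IsPosPowerOf : {V : Set} → (V → V → V) → V → V → Set
IsPosPowerOf _∙_ y x = Σ ℕ λ k → y ≡ pow _∙_ x k

PowerAdj : {V : Set} → (V → V → V) → V → V → Set
PowerAdj _∙_ x y = x ≢ y × (IsPosPowerOf _∙_ y x ⊎ IsPosPowerOf _∙_ x y)

-- Graph notions, for a graph with vertex type V and adjacency Adj.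
-- Vertex sets are duplicate-free lists; Γ - S has vertices outside S.

module _ {V : Set} (Adj : V → V → Set) where

  -- y is reachable from x in Γ - S (x itself assumed outside S)
  data Reach (S : List V) : V → V → Set where
    here : ∀ {x} → Reach S x x
    step : ∀ {x y z} → Adj x y → y ∉ S → Reach S y z → Reach S x z

  Disconnected : List V → Set
  Disconnected S = Σ V λ x → Σ V λ y → x ∉ S × y ∉ S × ¬ Reach S x y

  AtMostTrivial : List V → Set
  AtMostTrivial S = ∀ x y → x ∉ S → y ∉ S → x ≡ y

  IsVertexCut : List V → Set
  IsVertexCut S = Unique S × (Disconnected S ⊎ AtMostTrivial S)

  IsVertexConnectivity : ℕ → Set
  IsVertexConnectivity k =
    (Σ (List V) λ S → IsVertexCut S × length S ≡ k)
    × (∀ S → IsVertexCut S → k ≤ length S)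

  IsCycle : List V → V → List V → Set
  IsCycle S x xs =
    Unique (x ∷ xs) × 2 ≤ length xs × All (_∉ S) (x ∷ xs)
    × Linked Adj (x ∷ xs ++ x ∷ [])

  IsCyclicVertexCut : List V → Set
  IsCyclicVertexCut S =
    Unique S ×
    (Σ V λ x → Σ (List V) λ xs → Σ V λ y → Σ (List V) λ ys →
       IsCycle S x xs × IsCycle S y ys × ¬ Reach S x y)

data ℕ∞ : Set where
  fin : ℕ → ℕ∞
  ∞   : ℕ∞

module _ {V : Set} (Adj : V → V → Set) where

  IsCyclicVertexConnectivity : ℕ∞ → Set
  IsCyclicVertexConnectivity (fin k) =
    (Σ (List V) λ S → IsCyclicVertexCut Adj S × length S ≡ k)
    × (∀ S → IsCyclicVertexCut Adj S → k ≤ length S)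
  IsCyclicVertexConnectivity ∞ = ∀ S → ¬ IsCyclicVertexCut Adj S

  KappaNeqCKappa : Set
  KappaNeqCKappa =
    Σ ℕ λ k → Σ ℕ∞ λ c →
      IsVertexConnectivity Adj k × IsCyclicVertexConnectivity c × c ≢ fin k

-- The identity e is a power of every element, so it is a hub of 𝒫(G). In D₂ₙ a reflection x
-- has powers x and e only, so {e} separates reflections and κ = 1. In Q₄ₙ a reflection x has
-- powers x, aⁿ, x⁻¹ = aⁿx, e, so {e, aⁿ} separates x from the other reflections; one vertex does
-- not suffice, because once e is removed aⁿ becomes a hub (the square of every reflection, and
-- a power of the generators a and a⁻¹ of the rotations), so κ = 2. No cut of size κ is cyclic:
-- if it misses e (or aⁿ together with a generator) the rest stays connected, and otherwise each
-- reflection keeps at most one neighbour, so lies on no cycle, while all rotations ≠ e are joined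
-- through a generator outside the cut. As the graph is finite, cκ exists (possibly ∞) by
-- exhaustive search, and by the above it differs from κ.
module Submission where

open import Defs
open import Data.Bool using (Bool; true; false)
import Data.Bool.Properties as Bool
open import Data.Empty using (⊥-elim)
open import Data.Fin using (Fin; zero; suc; toℕ; fromℕ; fromℕ<)
import Data.Fin.Properties as Fin
open import Data.List using (List; []; _∷_; _++_; length; filter; allFin; cartesianProduct)
open import Data.List.Properties using (filter-notAll)
open import Data.List.Membership.Propositional using (_∈_; _∉_; lose; find)
open import Data.List.Membership.Propositional.Properties using (∈-filter⁺; ∈-cartesianProduct⁺; ∈-allFin)
open import Data.List.Relation.Binary.Subset.Propositional using (_⊆_)
open import Data.List.Relation.Unary.All as All using (All; []; _∷_; all?)
open import Data.List.Relation.Unary.AllPairs using ([]; _∷_)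
open import Data.List.Relation.Unary.Any using (here; there; any?)
open import Data.List.Relation.Unary.Linked using (Linked; _∷_; linked?)
open import Data.List.Relation.Unary.Unique.Propositional using (Unique)
open import Data.Nat using (ℕ; zero; suc; _+_; _*_; _∸_; _≤_; _<_; z≤n; s≤s; _≤?_; _%_; _/_)
import Data.Nat.Properties as ℕ
open import Data.Nat.DivMod using (_mod_; m%n<n; m%n%n≡m%n; %-distribˡ-+; [m+n]%n≡m%n; [m+kn]%n≡m%n; m<n⇒m%n≡m; n%n≡0; m*n%n≡0; m≡m%n+[m/n]*n)
open import Data.Nat.Tactic.RingSolver using (solve-∀)
open import Algebra.Properties.CommutativeSemigroup ℕ.+-commutativeSemigroup using () renaming (xy∙z≈xz∙y to +-right-comm)
open import Data.Product using (∃; _×_; _,_; proj₁; proj₂)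
open import Data.Product.Properties using (≡-dec)
open import Data.Sum using (_⊎_; inj₁; inj₂; [_,_]′)
open import Function using (id)
open import Relation.Binary.Construct.Closure.ReflexiveTransitive using (Star; ε; _◅_; _◅◅_)
open import Relation.Binary.Definitions using (Decidable; DecidableEquality)
open import Relation.Binary.PropositionalEquality using (_≡_; _≢_; ≢-sym; refl; sym; trans; cong; subst; module ≡-Reasoning)
open import Relation.Nullary using (¬_; Dec; yes; no)
open import Relation.Nullary.Decidable using (_×-dec_; _⊎-dec_; ¬?; map′)
import Relation.Unary as U

Unique-⊆⇒length≤ : ∀ {V : Set} → DecidableEquality V → ∀ {xs ys : List V} →
  Unique xs → xs ⊆ ys → length xs ≤ length ys
Unique-⊆⇒length≤ _≟_ {[]} _ _ = z≤n
Unique-⊆⇒length≤ _≟_ {x ∷ xs} {ys} (x∉xs ∷ xs!) x∷xs⊆ys = ℕ.≤-trans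
  (s≤s (Unique-⊆⇒length≤ _≟_ xs! λ z∈xs →
    ∈-filter⁺ (λ v → ¬? (x ≟ v)) (x∷xs⊆ys (there z∈xs)) (All.lookup x∉xs z∈xs)))
  (filter-notAll (λ v → ¬? (x ≟ v)) ys (lose (x∷xs⊆ys (here refl)) λ x≢x → x≢x refl))

∉-pair : ∀ {V : Set} {u v x y z : V} → x ∈ u ∷ v ∷ [] → y ∈ u ∷ v ∷ [] →
  x ≢ y → z ≢ x → z ≢ y → z ∉ u ∷ v ∷ []
∉-pair (here refl) (here refl) x≢y _ _ _ = x≢y refl
∉-pair (here refl) (there (here refl)) _ z≢x z≢y (here refl) = z≢x refl
∉-pair (here refl) (there (here refl)) _ z≢x z≢y (there (here refl)) = z≢y refl
∉-pair (there (here refl)) (here refl) _ z≢x z≢y (here refl) = z≢y refl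
∉-pair (there (here refl)) (here refl) _ z≢x z≢y (there (here refl)) = z≢x refl
∉-pair (there (here refl)) (there (here refl)) x≢y _ _ _ = x≢y refl

Linked-last : ∀ {V : Set} {R : V → V → Set} u vs {x} → Linked R (u ∷ vs ++ x ∷ []) →
  ∃ λ z → z ∈ u ∷ vs × R z x
Linked-last u [] (r ∷ _) = u , here refl , r
Linked-last u (v ∷ vs) (_ ∷ l) with Linked-last v vs l
... | z , z∈ , r = z , there z∈ , r

∉⇒≢ : ∀ {V : Set} {S : List V} {w u} → w ∉ S → u ∈ S → w ≢ u
∉⇒≢ w∉ u∈ refl = w∉ u∈

∉-∷[] : ∀ {V : Set} {u v : V} → u ≢ v → u ∉ v ∷ []
∉-∷[] u≢v (here u≡v) = u≢v u≡v

-- Reachability, cycles and cuts in Γ - S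

module _ {V : Set} (Adj : V → V → Set) (S : List V) where

  AtMostOneNeighbour : V → Set
  AtMostOneNeighbour x = ∀ {y z} → Adj x y → Adj x z → y ∉ S → z ∉ S → y ≡ z

  Connected : Set
  Connected = ∀ x y → x ∉ S → y ∉ S → Reach Adj S x y

module _ {V : Set} {Adj : V → V → Set} {S : List V} where

  Reach-trans : ∀ {x y z} → Reach Adj S x y → Reach Adj S y z → Reach Adj S x z
  Reach-trans here r = r
  Reach-trans (step a y∉ r) r′ = step a y∉ (Reach-trans r r′)

  Reach-sym : (∀ {x y} → Adj x y → Adj y x) → ∀ {x y} → x ∉ S → Reach Adj S x y → Reach Adj S y x
  Reach-sym sym-Adj x∉ here = here
  Reach-sym sym-Adj x∉ (step a y∉ r) = Reach-trans (Reach-sym sym-Adj y∉ r) (step (sym-Adj a) x∉ here)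

  Reach-invariant : {P : V → Set} → (∀ {z w} → P z → Adj z w → w ∉ S → P w) →
    ∀ {x y} → P x → Reach Adj S x y → P y
  Reach-invariant preserves px here = px
  Reach-invariant preserves px (step a w∉ r) = Reach-invariant preserves (preserves px a w∉) r

  Star⇒Reach : ∀ {x y} → Star (λ z w → Adj z w × w ∉ S) x y → Reach Adj S x y
  Star⇒Reach ε = here
  Star⇒Reach ((a , w∉) ◅ s) = step a w∉ (Star⇒Reach s)

  Reach⇒Star : ∀ {x y} → Reach Adj S x y → Star (λ z w → Adj z w × w ∉ S) x y
  Reach⇒Star here = ε
  Reach⇒Star (step a w∉ r) = (a , w∉) ◅ Reach⇒Star r

  IsCycle⇒head∉ : ∀ {x xs} → IsCycle Adj S x xs → x ∉ S
  IsCycle⇒head∉ (_ , _ , x∉ ∷ _ , _) = x∉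

  IsCycle⇒two-neighbours : ∀ {x xs} → IsCycle Adj S x xs →
    ∃ λ y → ∃ λ z → y ≢ z × Adj x y × Adj z x × y ∉ S × z ∉ S
  IsCycle⇒two-neighbours {xs = []} (_ , () , _)
  IsCycle⇒two-neighbours {xs = _ ∷ []} (_ , s≤s () , _)
  IsCycle⇒two-neighbours {xs = y ∷ y′ ∷ ys} (_ ∷ y∉ys ∷ _ , _ , _ ∷ y∉ ∷ ys∉ , x-y ∷ _ ∷ l)
    with Linked-last y′ ys l
  ... | z , z∈ , z-x = y , z , All.lookup y∉ys z∈ , x-y , z-x , y∉ , All.lookup ys∉ z∈

  AtMostOneNeighbour⇒¬IsCycle : (∀ {x y} → Adj x y → Adj y x) → ∀ {x xs} →
    AtMostOneNeighbour Adj S x → ¬ IsCycle Adj S x xs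
  AtMostOneNeighbour⇒¬IsCycle sym-Adj lonely c with IsCycle⇒two-neighbours c
  ... | y , z , y≢z , x-y , z-x , y∉ , z∉ = y≢z (lonely x-y (sym-Adj z-x) y∉ z∉)

  connected-via-hub : (∀ {x y} → Adj x y → Adj y x) → ∀ {h} →
    (∀ x → x ∉ S → Reach Adj S x h) → Connected Adj S
  connected-via-hub sym-Adj to-h x y x∉ y∉ = Reach-trans (to-h x x∉) (Reach-sym sym-Adj y∉ (to-h y y∉))

  Connected⇒¬IsVertexCut : Connected Adj S → ¬ AtMostTrivial Adj S → ¬ IsVertexCut Adj S
  Connected⇒¬IsVertexCut conn _ (_ , inj₁ (x , y , x∉ , y∉ , x↛y)) = x↛y (conn x y x∉ y∉)
  Connected⇒¬IsVertexCut _ nontrivial (_ , inj₂ trivial) = nontrivial trivial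

  Connected⇒¬IsCyclicVertexCut : Connected Adj S → ¬ IsCyclicVertexCut Adj S
  Connected⇒¬IsCyclicVertexCut conn (_ , x , _ , y , _ , cx , cy , x↛y) =
    x↛y (conn x y (IsCycle⇒head∉ cx) (IsCycle⇒head∉ cy))

¬AtMostTrivial-∷[] : ∀ {V : Set} {Adj : V → V → Set} → DecidableEquality V → ∀ {v x y z} →
  x ≢ y → x ≢ z → y ≢ z → ¬ AtMostTrivial Adj (v ∷ [])
¬AtMostTrivial-∷[] _≟_ {v} {x} {y} {z} x≢y x≢z y≢z trivial with x ≟ v | y ≟ v
... | yes refl | _ = y≢z (trivial y z (∉-∷[] (≢-sym x≢y)) (∉-∷[] (≢-sym x≢z)))
... | no x≢v | yes refl = x≢z (trivial x z (∉-∷[] x≢v) (∉-∷[] (≢-sym y≢z)))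
... | no x≢v | no y≢v = x≢y (trivial x y (∉-∷[] x≢v) (∉-∷[] y≢v))

module _ {V : Set} {_∙_ : V → V → V} where

  PowerAdj-sym : ∀ {x y} → PowerAdj _∙_ x y → PowerAdj _∙_ y x
  PowerAdj-sym (x≢y , inj₁ p) = ≢-sym x≢y , inj₂ p
  PowerAdj-sym (x≢y , inj₂ p) = ≢-sym x≢y , inj₁ p

  comparable⇒Reach : DecidableEquality V → ∀ {S x y} → y ∉ S →
    IsPosPowerOf _∙_ y x ⊎ IsPosPowerOf _∙_ x y → Reach (PowerAdj _∙_) S x y
  comparable⇒Reach _≟_ {x = x} {y} y∉ comparable with x ≟ y
  ... | yes refl = here
  ... | no x≢y = step (x≢y , comparable) y∉ here

  universal-power⇒Connected : DecidableEquality V → ∀ {S h} → h ∉ S → (∀ x → IsPosPowerOf _∙_ h x) →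
    Connected (PowerAdj _∙_) S
  universal-power⇒Connected _≟_ h∉ h-power =
    connected-via-hub PowerAdj-sym λ x _ → comparable⇒Reach _≟_ h∉ (inj₁ (h-power x))

-- Exhaustive search on finite graphs

least-or-none : {P : ℕ → Set} → U.Decidable P → ∀ m →
  (∃ λ k → P k × (∀ j → j < k → ¬ P j)) ⊎ (∀ j → j < m → ¬ P j)
least-or-none P? zero = inj₂ λ _ ()
least-or-none P? (suc m) with least-or-none P? m
... | inj₁ least = inj₁ least
... | inj₂ none with P? m
...   | yes pm = inj₁ (m , pm , none)
...   | no ¬pm = inj₂ none-below-suc
  where
    none-below-suc : ∀ j → j < suc m → ¬ _
    none-below-suc j (s≤s j≤m) with ℕ.m≤n⇒m<n∨m≡n j≤m
    ... | inj₁ j<m = none j j<m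
    ... | inj₂ refl = ¬pm

module FiniteSearch {V : Set} (_≟_ : DecidableEquality V) (enum : List V) (complete : ∀ x → x ∈ enum) where

  open import Data.List.Membership.DecPropositional _≟_ using (_∈?_)
  open import Data.List.Relation.Unary.Unique.DecPropositional _≟_ using (unique?)

  N : ℕ
  N = length enum

  Unique⇒length≤ : ∀ {xs} → Unique xs → length xs ≤ N
  Unique⇒length≤ xs! = Unique-⊆⇒length≤ _≟_ xs! λ {x} _ → complete x

  ∃? : {P : V → Set} → U.Decidable P → Dec (∃ P)
  ∃? P? with any? P? enum
  ... | yes some = yes (let x , _ , px = find some in x , px)
  ... | no none = no λ (x , px) → none (lose (complete x) px)

  ∃-bounded-list? : ∀ k {P : List V → Set} → U.Decidable P → Dec (∃ λ xs → length xs ≤ k × P xs)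
  ∃-bounded-list? k P? with P? []
  ... | yes p[] = yes ([] , z≤n , p[])
  ∃-bounded-list? zero P? | no ¬p[] = no λ { ([] , _ , p) → ¬p[] p ; (_ ∷ _ , () , _) }
  ∃-bounded-list? (suc k) {P} P? | no ¬p[]
    with ∃? (λ x → ∃-bounded-list? k {λ xs → P (x ∷ xs)} (λ xs → P? (x ∷ xs)))
  ... | yes (x , xs , len , p) = yes (x ∷ xs , s≤s len , p)
  ... | no ¬cons = no λ { ([] , _ , p) → ¬p[] p ; (x ∷ xs , s≤s len , p) → ¬cons (x , xs , len , p) }

  ∃-list? : {P : List V → Set} → U.Decidable P → (∀ {xs} → P xs → length xs ≤ N) → Dec (∃ P)
  ∃-list? P? bound = map′ (λ (xs , _ , p) → xs , p) (λ (xs , p) → xs , bound p , p) (∃-bounded-list? N P?)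

  module _ {E : V → V → Set} (E? : Decidable E) where

    record Closure (x : V) : Set where
      field
        members : List V
        start : x ∈ members
        sound : All (Star E x) members
        closed : ∀ {z w} → z ∈ members → E z w → w ∈ members

    -- C absorbs one new E-successor per round; the candidates R shrink each time, so fuel ≥ length R suffices
    close : ∀ {x} fuel (C R : List V) → length R ≤ fuel → x ∈ C → All (Star E x) C →
      (∀ v → v ∈ C ⊎ v ∈ R) → Closure x
    close zero C [] _ start sound covers = record
      { members = C ; start = start ; sound = sound
      ; closed = λ {_} {w} _ _ → [ id , (λ ()) ]′ (covers w) }
    close (suc fuel) C R bound start sound covers with any? (λ w → any? (λ z → E? z w) C) R
    ... | no ¬new = record
      { members = C ; start = start ; sound = sound
      ; closed = λ {_} {w} z∈ e → [ id , (λ w∈R → ⊥-elim (¬new (lose w∈R (lose z∈ e)))) ]′ (covers w) }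
    ... | yes new with find new
    ... | w , w∈R , w-new with find w-new
    ... | z , z∈ , e = close fuel (w ∷ C) (filter (λ v → ¬? (w ≟ v)) R)
            (ℕ.≤-pred (ℕ.≤-trans (filter-notAll (λ v → ¬? (w ≟ v)) R (lose w∈R λ w≢w → w≢w refl))
                                 bound))
            (there start) ((All.lookup sound z∈ ◅◅ (e ◅ ε)) ∷ sound) covers′
      where
        covers′ : ∀ v → v ∈ w ∷ C ⊎ v ∈ filter (λ v → ¬? (w ≟ v)) R
        covers′ v with covers v | w ≟ v
        ... | inj₁ v∈C | _ = inj₁ (there v∈C)
        ... | inj₂ _ | yes refl = inj₁ (here refl)
        ... | inj₂ v∈R | no w≢v = inj₂ (∈-filter⁺ (λ v → ¬? (w ≟ v)) v∈R w≢v)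

    closure : ∀ x → Closure x
    closure x = close N (x ∷ []) enum ℕ.≤-refl (here refl) (ε ∷ []) (λ v → inj₂ (complete v))

    Star? : Decidable (Star E)
    Star? x y with closure x
    ... | C with y ∈? Closure.members C
    ...   | yes y∈ = yes (All.lookup (Closure.sound C) y∈)
    ...   | no y∉ = no λ s → y∉ (stays (Closure.start C) s)
      where
        stays : ∀ {z} → z ∈ Closure.members C → Star E z y → y ∈ Closure.members C
        stays z∈ ε = z∈
        stays z∈ (e ◅ s) = stays (Closure.closed C z∈ e) s

  module _ (_∙_ : V → V → V) where

    pow-Star : ∀ {x} k → Star (λ z w → w ≡ x ∙ z) x (pow _∙_ x k)
    pow-Star zero = ε
    pow-Star (suc k) = pow-Star k ◅◅ (refl ◅ ε)

    Star-pow : ∀ {x y} k → Star (λ z w → w ≡ x ∙ z) (pow _∙_ x k) y → IsPosPowerOf _∙_ y x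
    Star-pow k ε = k , refl
    Star-pow k (refl ◅ s) = Star-pow (suc k) s

    IsPosPowerOf? : ∀ y x → Dec (IsPosPowerOf _∙_ y x)
    IsPosPowerOf? y x = map′ (Star-pow 0) (λ (k , y≡) → subst (Star _ x) (sym y≡) (pow-Star k))
      (Star? (λ z w → w ≟ (x ∙ z)) x y)

    PowerAdj? : Decidable (PowerAdj _∙_)
    PowerAdj? x y = ¬? (x ≟ y) ×-dec (IsPosPowerOf? y x ⊎-dec IsPosPowerOf? x y)

  module _ {Adj : V → V → Set} (Adj? : Decidable Adj) where

    Reach? : ∀ S → Decidable (Reach Adj S)
    Reach? S x y = map′ Star⇒Reach Reach⇒Star (Star? (λ z w → Adj? z w ×-dec ¬? (w ∈? S)) x y)

    IsCycle? : ∀ S x xs → Dec (IsCycle Adj S x xs)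
    IsCycle? S x xs = unique? (x ∷ xs) ×-dec (2 ≤? length xs) ×-dec all? (λ v → ¬? (v ∈? S)) (x ∷ xs)
      ×-dec linked? Adj? (x ∷ xs ++ x ∷ [])

    IsCycle⇒length≤ : ∀ {S x xs} → IsCycle Adj S x xs → length xs ≤ N
    IsCycle⇒length≤ (_ ∷ xs! , _) = Unique⇒length≤ xs!

    IsCyclicVertexCut? : ∀ S → Dec (IsCyclicVertexCut Adj S)
    IsCyclicVertexCut? S = unique? S ×-dec
      ∃? λ x → ∃-list? (λ xs → ∃? λ y → ∃-list?
          (λ ys → IsCycle? S x xs ×-dec IsCycle? S y ys ×-dec ¬? (Reach? S x y))
          λ (_ , cy , _) → IsCycle⇒length≤ cy)
        λ (_ , _ , cx , _) → IsCycle⇒length≤ cx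

    cyclicVertexConnectivity : ∃ (IsCyclicVertexConnectivity Adj)
    cyclicVertexConnectivity with least-or-none CutOfSize? (suc N)
      where
        CutOfSize? : ∀ k → Dec (∃ λ S → IsCyclicVertexCut Adj S × length S ≡ k)
        CutOfSize? k = map′ (λ (S , _ , p) → S , p) (λ (S , p) → S , ℕ.≤-reflexive (proj₂ p) , p)
          (∃-bounded-list? k λ S → IsCyclicVertexCut? S ×-dec (length S ℕ.≟ k))
    ... | inj₁ (k , cut , below) = fin k , cut , minimal
      where
        minimal : ∀ S → IsCyclicVertexCut Adj S → k ≤ length S
        minimal S cutS with k ≤? length S
        ... | yes k≤ = k≤
        ... | no k≰ = ⊥-elim (below (length S) (ℕ.≰⇒> k≰) (S , cutS , refl))
    ... | inj₂ none = ∞ , λ S cutS → none (length S) (s≤s (Unique⇒length≤ (proj₁ cutS))) (S , cutS , refl)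

    KappaNeqCKappa-intro : ∀ k → IsVertexConnectivity Adj k →
      (∀ S → length S ≡ k → ¬ IsCyclicVertexCut Adj S) → KappaNeqCKappa Adj
    KappaNeqCKappa-intro k κ no-cut =
      let c , cκ = cyclicVertexConnectivity in k , c , κ , cκ , c≢k cκ
      where
        c≢k : ∀ {c} → IsCyclicVertexConnectivity Adj c → c ≢ fin k
        c≢k ((S , cut , len) , _) refl = no-cut S len cut

module RotationReflection (k : ℕ) where

  m : ℕ
  m = suc (suc k)

  Elt : Set
  Elt = Fin m × Bool

  e a a⁻¹ : Elt
  e = zero , false
  a = suc zero , false
  a⁻¹ = fromℕ (suc k) , false

  _≟_ : DecidableEquality Elt
  _≟_ = ≡-dec Fin._≟_ Bool._≟_

  enum : List Elt
  enum = cartesianProduct (allFin m) (false ∷ true ∷ [])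

  complete : ∀ x → x ∈ enum
  complete (i , b) = ∈-cartesianProduct⁺ {xs = allFin m} {ys = false ∷ true ∷ []} (∈-allFin i) (b∈ b)
    where
      b∈ : ∀ b → b ∈ false ∷ true ∷ []
      b∈ false = here refl
      b∈ true = there (here refl)

  rot-≢ : ∀ {i j : Fin m} → toℕ i ≢ toℕ j → (i , false) ≢ (j , false)
  rot-≢ i≢j eq = i≢j (cong (λ x → toℕ (proj₁ x)) eq)

  ref≢rot : ∀ {i j : Fin m} → (i , true) ≢ (j , false)
  ref≢rot ()

  open ≡-Reasoning

  toℕ-mod : ∀ x → toℕ (x mod m) ≡ x % m
  toℕ-mod x = Fin.toℕ-fromℕ< (m%n<n x m)

  mod-cong : ∀ x y → x % m ≡ y % m → x mod m ≡ y mod m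
  mod-cong x y eq = Fin.toℕ-injective (trans (toℕ-mod x) (trans eq (sym (toℕ-mod y))))

  toℕ-mod-inverse : ∀ i → toℕ i mod m ≡ i
  toℕ-mod-inverse i = Fin.toℕ-injective (trans (toℕ-mod (toℕ i)) (m<n⇒m%n≡m (Fin.toℕ<n i)))

  +-toℕ-mod : ∀ x y → (x + toℕ (y mod m)) mod m ≡ (x + y) mod m
  +-toℕ-mod x y = mod-cong (x + toℕ (y mod m)) (x + y) (begin
    (x + toℕ (y mod m)) % m   ≡⟨ cong (λ t → (x + t) % m) (toℕ-mod y) ⟩
    (x + y % m) % m           ≡⟨ %-distribˡ-+ x (y % m) m ⟩
    (x % m + y % m % m) % m   ≡⟨ cong (λ t → (x % m + t) % m) (m%n%n≡m%n y m) ⟩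
    (x % m + y % m) % m       ≡⟨ %-distribˡ-+ x y m ⟨
    (x + y) % m               ∎)

  toℕ-mod-+ : ∀ x y → (toℕ (x mod m) + y) mod m ≡ (x + y) mod m
  toℕ-mod-+ x y = begin
    (toℕ (x mod m) + y) mod m ≡⟨ cong (_mod m) (ℕ.+-comm (toℕ (x mod m)) y) ⟩
    (y + toℕ (x mod m)) mod m ≡⟨ +-toℕ-mod y x ⟩
    (y + x) mod m             ≡⟨ cong (_mod m) (ℕ.+-comm y x) ⟩
    (x + y) mod m             ∎

  +m-mod : ∀ x → (x + m) mod m ≡ x mod m
  +m-mod x = mod-cong (x + m) x ([m+n]%n≡m%n x m)

  +[m∸%]-mod : ∀ x → (x + (m ∸ x % m)) mod m ≡ zero
  +[m∸%]-mod x = mod-cong (x + (m ∸ x % m)) 0 (begin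
    (x + (m ∸ r)) % m         ≡⟨ cong (λ t → (t + (m ∸ r)) % m) (m≡m%n+[m/n]*n x m) ⟩
    (r + q * m + (m ∸ r)) % m ≡⟨ cong (_% m) (+-right-comm r (q * m) (m ∸ r)) ⟩
    (r + (m ∸ r) + q * m) % m ≡⟨ [m+kn]%n≡m%n (r + (m ∸ r)) q m ⟩
    (r + (m ∸ r)) % m         ≡⟨ cong (_% m) (ℕ.m+[n∸m]≡n (ℕ.<⇒≤ (m%n<n x m))) ⟩
    m % m                     ≡⟨ n%n≡0 m ⟩
    0                         ∎)
    where
      r = x % m
      q = x / m

  module Group (_∙_ : Elt → Elt → Elt)
    (rot∙rot : ∀ i j → (i , false) ∙ (j , false) ≡ ((toℕ i + toℕ j) mod m , false))
    (ref∙rot : ∀ i j → (i , true) ∙ (j , false) ≡ ((toℕ i + (m ∸ toℕ j)) mod m , true)) where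

    Adj : Elt → Elt → Set
    Adj = PowerAdj _∙_

    rot-pow : ∀ i t → pow _∙_ (i , false) t ≡ ((suc t * toℕ i) mod m , false)
    rot-pow i zero = cong (_, false) (sym (trans (cong (_mod m) (ℕ.+-identityʳ (toℕ i))) (toℕ-mod-inverse i)))
    rot-pow i (suc t) = begin
      (i , false) ∙ pow _∙_ (i , false) t               ≡⟨ cong ((i , false) ∙_) (rot-pow i t) ⟩
      (i , false) ∙ ((suc t * toℕ i) mod m , false)     ≡⟨ rot∙rot i _ ⟩
      ((toℕ i + toℕ ((suc t * toℕ i) mod m)) mod m , false) ≡⟨ cong (_, false) (+-toℕ-mod (toℕ i) _) ⟩
      ((suc (suc t) * toℕ i) mod m , false)             ∎

    e-power-of-rot : ∀ i → IsPosPowerOf _∙_ e (i , false)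
    e-power-of-rot i = suc k , sym (trans (rot-pow i (suc k))
      (cong (_, false) (mod-cong (m * toℕ i) 0 (trans (cong (_% m) (ℕ.*-comm m (toℕ i))) (m*n%n≡0 (toℕ i) m)))))

    power-of-a : ∀ j → IsPosPowerOf _∙_ (suc j , false) a
    power-of-a j = toℕ j , sym (trans (rot-pow (suc zero) (toℕ j))
      (cong (_, false) (trans (cong (_mod m) (ℕ.*-identityʳ (suc (toℕ j)))) (toℕ-mod-inverse (suc j)))))

    -- aᵗ = (a⁻¹)^(m - t) since (m - t)(m - 1) ≡ t (mod m)
    power-of-a⁻¹ : ∀ j → IsPosPowerOf _∙_ (suc j , false) a⁻¹
    power-of-a⁻¹ j = c , sym (begin
      pow _∙_ a⁻¹ c                            ≡⟨ rot-pow (fromℕ (suc k)) c ⟩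
      ((suc c * toℕ (fromℕ (suc k))) mod m , false)
        ≡⟨ cong (λ u → (suc c * u) mod m , false) (trans (Fin.toℕ-fromℕ (suc k)) 1+k≡t+c) ⟩
      ((suc c * (t + c)) mod m , false)        ≡⟨ cong (λ u → u mod m , false) (expand t c) ⟩
      ((t + c * (t + suc c)) mod m , false)    ≡⟨ cong (λ u → (t + c * u) mod m , false) t+1+c≡m ⟩
      ((t + c * m) mod m , false)              ≡⟨ cong (_, false) (mod-cong (t + c * m) t ([m+kn]%n≡m%n t c m)) ⟩
      (t mod m , false)                        ≡⟨ cong (_, false) (toℕ-mod-inverse (suc j)) ⟩
      (suc j , false)                          ∎)
      where
        t = toℕ (suc j)
        c = suc k ∸ t
        1+k≡t+c : suc k ≡ t + c
        1+k≡t+c = sym (ℕ.m+[n∸m]≡n (ℕ.≤-pred (Fin.toℕ<n (suc j))))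
        t+1+c≡m : t + suc c ≡ m
        t+1+c≡m = trans (ℕ.+-suc t c) (cong suc (sym 1+k≡t+c))
        expand : ∀ t c → suc c * (t + c) ≡ t + c * (t + suc c)
        expand = solve-∀

    ref∙e : ∀ i → (i , true) ∙ e ≡ (i , true)
    ref∙e i = trans (ref∙rot i zero) (cong (_, true) (trans (+m-mod (toℕ i)) (toℕ-mod-inverse i)))

    -- A reflection with at most one neighbour lies on no cycle, so every cycle of Γ - S
    -- starts at a rotation aʲ ≠ e, and all of these are joined through a.
    lonely-reflections⇒¬IsCyclicVertexCut : ∀ {S} → e ∈ S → a ∉ S →
      (∀ i → AtMostOneNeighbour Adj S (i , true)) → ¬ IsCyclicVertexCut Adj S
    lonely-reflections⇒¬IsCyclicVertexCut {S} e∈S a∉S lonely (_ , x , _ , y , _ , cx , cy , x↛y) =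
      x↛y (Reach-trans (head↝a cx) (Reach-sym PowerAdj-sym (IsCycle⇒head∉ cy) (head↝a cy)))
      where
        head↝a : ∀ {x xs} → IsCycle Adj S x xs → Reach Adj S x a
        head↝a {zero , false} c = ⊥-elim (IsCycle⇒head∉ c e∈S)
        head↝a {suc j , false} _ = comparable⇒Reach _≟_ a∉S (inj₂ (power-of-a j))
        head↝a {i , true} c = ⊥-elim (AtMostOneNeighbour⇒¬IsCycle PowerAdj-sym (lonely i) c)

module Dihedral (p : ℕ) where

  open RotationReflection (suc p)
  open Group (mulD m) (λ _ _ → refl) (λ _ _ → refl)
  open FiniteSearch _≟_ enum complete

  ref-square : ∀ i → mulD m (i , true) (i , true) ≡ e
  ref-square i = cong (_, false) (mod-cong (toℕ i + (m ∸ toℕ i)) 0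
    (trans (cong (_% m) (ℕ.m+[n∸m]≡n (ℕ.<⇒≤ (Fin.toℕ<n i)))) (n%n≡0 m)))

  ref-pow : ∀ i t → pow (mulD m) (i , true) t ∈ (i , true) ∷ e ∷ []
  ref-pow i zero = here refl
  ref-pow i (suc t) with ref-pow i t
  ... | here eq = there (here (trans (cong (mulD m (i , true)) eq) (ref-square i)))
  ... | there (here eq) = here (trans (cong (mulD m (i , true)) eq) (ref∙e i))

  ref-neighbour : ∀ i {w} → Adj (i , true) w → w ≡ e
  ref-neighbour i (x≢w , inj₁ (t , w≡)) with ref-pow i t
  ... | here eq = ⊥-elim (x≢w (sym (trans w≡ eq)))
  ... | there (here eq) = trans w≡ eq
  ref-neighbour i {j , false} (_ , inj₂ (t , x≡)) = ⊥-elim (ref≢rot (trans x≡ (rot-pow j t)))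
  ref-neighbour i {j , true} (x≢w , inj₂ (t , x≡)) with ref-pow j t
  ... | here eq = ⊥-elim (x≢w (trans x≡ eq))
  ... | there (here eq) = ⊥-elim (ref≢rot (trans x≡ eq))

  e-power : ∀ x → IsPosPowerOf (mulD m) e x
  e-power (i , false) = e-power-of-rot i
  e-power (i , true) = 1 , sym (ref-square i)

  x₀ y₀ : Elt
  x₀ = zero , true
  y₀ = suc zero , true

  x₀≢y₀ : x₀ ≢ y₀
  x₀≢y₀ ()

  κ≡1 : IsVertexConnectivity Adj 1
  κ≡1 = (e ∷ [] , ([] ∷ [] , inj₁ (x₀ , y₀ , ∉-∷[] (λ ()) , ∉-∷[] (λ ()) , x₀↛y₀)) , refl) ,
        1≤
    where
      x₀↛y₀ : ¬ Reach Adj (e ∷ []) x₀ y₀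
      x₀↛y₀ (step x₀-w w∉ _) = w∉ (here (ref-neighbour zero x₀-w))
      1≤ : ∀ S → IsVertexCut Adj S → 1 ≤ length S
      1≤ [] cut = ⊥-elim (Connected⇒¬IsVertexCut (universal-power⇒Connected _≟_ (λ ()) e-power)
        (λ trivial → x₀≢y₀ (trivial x₀ y₀ (λ ()) (λ ()))) cut)
      1≤ (_ ∷ _) _ = s≤s z≤n

  no-cyclic-cut : ∀ S → length S ≡ 1 → ¬ IsCyclicVertexCut Adj S
  no-cyclic-cut (v ∷ []) _ with v ≟ e
  ... | no v≢e = Connected⇒¬IsCyclicVertexCut
    (universal-power⇒Connected _≟_ (∉-∷[] (≢-sym v≢e)) e-power)
  ... | yes refl = lonely-reflections⇒¬IsCyclicVertexCut (here refl) (∉-∷[] λ ())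
    λ i x-y _ y∉ _ → ⊥-elim (y∉ (here (ref-neighbour i x-y)))

  κ≢cκ : KappaNeqCKappa Adj
  κ≢cκ = KappaNeqCKappa-intro (PowerAdj? (mulD m)) 1 κ≡1 no-cyclic-cut

module Dicyclic (q : ℕ) where

  n : ℕ
  n = suc (suc q)

  -- m = suc (suc k) is then definitionally 2 * n, the index of Q n
  open RotationReflection (q + suc (suc (q + 0)))
  open Group (mulQ n) (λ _ _ → refl) (λ _ _ → refl)
  open FiniteSearch _≟_ enum complete
  open import Data.List.Membership.DecPropositional _≟_ using (_∈?_)
  open ≡-Reasoning

  m≡n+n : m ≡ n + n
  m≡n+n = cong (n +_) (ℕ.+-identityʳ n)

  n<m : n < m
  n<m = subst (n <_) (sym m≡n+n) (ℕ.m<m+n n (s≤s z≤n))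

  h : Elt
  h = fromℕ< n<m , false

  toℕ-h : toℕ (proj₁ h) ≡ n
  toℕ-h = Fin.toℕ-fromℕ< n<m

  -- (bar i , true) = aⁿ · aⁱb is the inverse of aⁱb
  bar : Fin m → Fin m
  bar i = (toℕ i + n) mod m

  bar-involutive : ∀ i → bar (bar i) ≡ i
  bar-involutive i = begin
    (toℕ ((toℕ i + n) mod m) + n) mod m ≡⟨ toℕ-mod-+ (toℕ i + n) n ⟩
    (toℕ i + n + n) mod m               ≡⟨ cong (_mod m) (ℕ.+-assoc (toℕ i) n n) ⟩
    (toℕ i + (n + n)) mod m             ≡⟨ cong (λ u → (toℕ i + u) mod m) m≡n+n ⟨
    (toℕ i + m) mod m                   ≡⟨ +m-mod (toℕ i) ⟩
    toℕ i mod m                         ≡⟨ toℕ-mod-inverse i ⟩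
    i                                   ∎

  ref-square : ∀ i → mulQ n (i , true) (i , true) ≡ h
  ref-square i = cong (_, false) (begin
    (toℕ i + (m ∸ toℕ i) + n) mod m
      ≡⟨ cong (λ u → (u + n) mod m) (ℕ.m+[n∸m]≡n (ℕ.<⇒≤ (Fin.toℕ<n i))) ⟩
    (m + n) mod m                   ≡⟨ cong (_mod m) (ℕ.+-comm m n) ⟩
    (n + m) mod m                   ≡⟨ +m-mod n ⟩
    n mod m                         ≡⟨ cong (_mod m) toℕ-h ⟨
    toℕ (proj₁ h) mod m             ≡⟨ toℕ-mod-inverse (proj₁ h) ⟩
    proj₁ h                         ∎)

  ref∙h : ∀ i → mulQ n (i , true) h ≡ (bar i , true)
  ref∙h i = cong (λ u → (toℕ i + u) mod m , true) (begin
    m ∸ toℕ (proj₁ h) ≡⟨ cong (m ∸_) toℕ-h ⟩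
    m ∸ n             ≡⟨ cong (_∸ n) m≡n+n ⟩
    n + n ∸ n         ≡⟨ ℕ.m+n∸m≡n n n ⟩
    n                 ∎)

  ref∙bar : ∀ i → mulQ n (i , true) (bar i , true) ≡ e
  ref∙bar i = cong (_, false) (begin
    (toℕ i + (m ∸ toℕ (bar i)) + n) mod m
      ≡⟨ cong (_mod m) (+-right-comm (toℕ i) (m ∸ toℕ (bar i)) n) ⟩
    (toℕ i + n + (m ∸ toℕ (bar i))) mod m
      ≡⟨ cong (λ u → (toℕ i + n + (m ∸ u)) mod m) (toℕ-mod (toℕ i + n)) ⟩
    (toℕ i + n + (m ∸ (toℕ i + n) % m)) mod m   ≡⟨ +[m∸%]-mod (toℕ i + n) ⟩
    zero                                        ∎)

  ref-pow : ∀ i t → pow (mulQ n) (i , true) t ∈ (i , true) ∷ h ∷ (bar i , true) ∷ e ∷ []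
  ref-pow i zero = here refl
  ref-pow i (suc t) with ref-pow i t
  ... | here eq = there (here (trans (cong (mulQ n (i , true)) eq) (ref-square i)))
  ... | there (here eq) = there (there (here (trans (cong (mulQ n (i , true)) eq) (ref∙h i))))
  ... | there (there (here eq)) = there (there (there (here (trans (cong (mulQ n (i , true)) eq) (ref∙bar i)))))
  ... | there (there (there (here eq))) = here (trans (cong (mulQ n (i , true)) eq) (ref∙e i))

  ref-neighbour : ∀ i {w} → Adj (i , true) w → w ≢ e → w ≢ h → w ≡ (bar i , true)
  ref-neighbour i (x≢w , inj₁ (t , w≡)) w≢e w≢h with ref-pow i t
  ... | here eq = ⊥-elim (x≢w (sym (trans w≡ eq)))
  ... | there (here eq) = ⊥-elim (w≢h (trans w≡ eq))
  ... | there (there (here eq)) = trans w≡ eq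
  ... | there (there (there (here eq))) = ⊥-elim (w≢e (trans w≡ eq))
  ref-neighbour i {j , false} (_ , inj₂ (t , x≡)) _ _ = ⊥-elim (ref≢rot (trans x≡ (rot-pow j t)))
  ref-neighbour i {j , true} (x≢w , inj₂ (t , x≡)) _ _ with ref-pow j t
  ... | here eq = ⊥-elim (x≢w (trans x≡ eq))
  ... | there (here eq) = ⊥-elim (ref≢rot (trans x≡ eq))
  ... | there (there (here eq)) =
    cong (_, true) (sym (trans (cong bar (cong proj₁ (trans x≡ eq))) (bar-involutive j)))
  ... | there (there (there (here eq))) = ⊥-elim (ref≢rot (trans x≡ eq))

  ref-neighbour-outside : ∀ {S} → e ∈ S → h ∈ S →
    ∀ i {w} → Adj (i , true) w → w ∉ S → w ≡ (bar i , true)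
  ref-neighbour-outside e∈ h∈ i x-w w∉ = ref-neighbour i x-w (∉⇒≢ w∉ e∈) (∉⇒≢ w∉ h∈)

  e-power : ∀ x → IsPosPowerOf (mulQ n) e x
  e-power (i , false) = e-power-of-rot i
  e-power (i , true) = 3 , sym (begin
    x ∙ (x ∙ (x ∙ x)) ≡⟨ cong (λ w → x ∙ (x ∙ w)) (ref-square i) ⟩
    x ∙ (x ∙ h)       ≡⟨ cong (x ∙_) (ref∙h i) ⟩
    x ∙ (bar i , true) ≡⟨ ref∙bar i ⟩
    e                 ∎)
    where
      x = i , true
      _∙_ = mulQ n

  -- h = aⁿ is the square of every reflection, and each rotation reaches it through a generator g ∉ S
  h-connected : ∀ {S g} → (∀ j → IsPosPowerOf (mulQ n) (suc j , false) g) → g ∉ S → h ∉ S →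
    Connected Adj S
  h-connected {S} {g} g-generates g∉ h∉ = connected-via-hub PowerAdj-sym to-h
    where
      to-h : ∀ x → x ∉ S → Reach Adj S x h
      to-h (i , true) _ = comparable⇒Reach _≟_ h∉ (inj₁ (1 , sym (ref-square i)))
      to-h (zero , false) _ = comparable⇒Reach _≟_ h∉ (inj₂ (e-power-of-rot (proj₁ h)))
      to-h (suc j , false) _ = Reach-trans (comparable⇒Reach _≟_ g∉ (inj₂ (g-generates j)))
        (Reach-sym PowerAdj-sym h∉ (comparable⇒Reach _≟_ g∉ (inj₂ (g-generates _))))

  x₀ y₀ : Elt
  x₀ = zero , true
  y₀ = suc zero , true

  x₀≢y₀ : x₀ ≢ y₀
  x₀≢y₀ ()

  x̄₀ : Elt
  x̄₀ = bar zero , true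

  S₂ : List Elt
  S₂ = e ∷ h ∷ []

  ref∉S₂ : ∀ {i} → (i , true) ∉ S₂
  ref∉S₂ (here ())
  ref∉S₂ (there (here ()))

  -- in Γ - {e, h} the component of x₀ is {x₀, x̄₀}, and x̄₀ = aⁿb ≠ y₀
  x₀↛y₀ : ¬ Reach Adj S₂ x₀ y₀
  x₀↛y₀ r with Reach-invariant preserves (inj₁ refl) r
    where
      outside : ∀ i {w} → Adj (i , true) w → w ∉ S₂ → w ≡ (bar i , true)
      outside = ref-neighbour-outside (here refl) (there (here refl))
      preserves : ∀ {z w} → z ≡ x₀ ⊎ z ≡ x̄₀ → Adj z w → w ∉ S₂ → w ≡ x₀ ⊎ w ≡ x̄₀
      preserves (inj₁ refl) x-w w∉ = inj₂ (outside zero x-w w∉)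
      preserves (inj₂ refl) x-w w∉ = inj₁ (trans (outside (bar zero) x-w w∉) (cong (_, true) (bar-involutive zero)))
  ... | inj₁ ()
  ... | inj₂ y₀≡x̄₀ with trans (cong (λ x → toℕ (proj₁ x)) y₀≡x̄₀) (trans (toℕ-mod n) (m<n⇒m%n≡m n<m))
  ...   | ()

  κ≡2 : IsVertexConnectivity Adj 2
  κ≡2 = (S₂ , (((λ ()) ∷ []) ∷ [] ∷ [] , inj₁ (x₀ , y₀ , ref∉S₂ , ref∉S₂ , x₀↛y₀)) , refl) ,
        2≤
    where
      singleton-connected : ∀ v → Connected Adj (v ∷ [])
      singleton-connected v with v ≟ e
      ... | no v≢e = universal-power⇒Connected _≟_ (∉-∷[] (≢-sym v≢e)) e-power
      ... | yes refl = h-connected power-of-a (∉-∷[] λ ()) (∉-∷[] λ ())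
      2≤ : ∀ S → IsVertexCut Adj S → 2 ≤ length S
      2≤ [] cut = ⊥-elim (Connected⇒¬IsVertexCut (universal-power⇒Connected _≟_ (λ ()) e-power)
        (λ trivial → x₀≢y₀ (trivial x₀ y₀ (λ ()) (λ ()))) cut)
      2≤ (v ∷ []) cut = ⊥-elim (Connected⇒¬IsVertexCut (singleton-connected v)
        (¬AtMostTrivial-∷[] {Adj = Adj} _≟_ {z = e} x₀≢y₀ (λ ()) (λ ())) cut)
      2≤ (_ ∷ _ ∷ _) _ = s≤s (s≤s z≤n)

  a≢h : a ≢ h
  a≢h = rot-≢ λ 1≡toℕh → 1≢n (trans 1≡toℕh toℕ-h)
    where
      1≢n : 1 ≢ n
      1≢n ()

  a⁻¹≢a : a⁻¹ ≢ a
  a⁻¹≢a = rot-≢ λ eq → ℕ.m+1+n≢0 q (ℕ.suc-injective (trans (sym (Fin.toℕ-fromℕ _)) eq))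

  no-cyclic-cut : ∀ S → length S ≡ 2 → ¬ IsCyclicVertexCut Adj S
  no-cyclic-cut S@(u ∷ v ∷ []) _ with e ∈? S | h ∈? S
  ... | no e∉ | _ = Connected⇒¬IsCyclicVertexCut (universal-power⇒Connected _≟_ e∉ e-power)
  ... | yes e∈ | yes h∈ = lonely-reflections⇒¬IsCyclicVertexCut e∈ (∉-pair e∈ h∈ (λ ()) (λ ()) a≢h)
    λ i x-y x-z y∉ z∉ →
      trans (ref-neighbour-outside e∈ h∈ i x-y y∉) (sym (ref-neighbour-outside e∈ h∈ i x-z z∉))
  ... | yes e∈ | no h∉ with a ∈? S
  ...   | no a∉ = Connected⇒¬IsCyclicVertexCut (h-connected power-of-a a∉ h∉)
  ...   | yes a∈ = Connected⇒¬IsCyclicVertexCut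
    (h-connected power-of-a⁻¹ (∉-pair e∈ a∈ (λ ()) (λ ()) a⁻¹≢a) h∉)

  κ≢cκ : KappaNeqCKappa Adj
  κ≢cκ = KappaNeqCKappa-intro (PowerAdj? (mulQ n)) 2 κ≡2 no-cyclic-cut

mainTheorem8 : ((n : ℕ) → 3 ≤ n → KappaNeqCKappa (PowerAdj (mulD n)))
    × ((n : ℕ) → 2 ≤ n → KappaNeqCKappa (PowerAdj (mulQ n)))
mainTheorem8 = dihedral , dicyclic
  where
    dihedral : (n : ℕ) → 3 ≤ n → KappaNeqCKappa (PowerAdj (mulD n))
    dihedral (suc (suc (suc p))) _ = Dihedral.κ≢cκ p
    dihedral (suc (suc zero)) (s≤s (s≤s ()))
    dihedral (suc zero) (s≤s ())

    dicyclic : (n : ℕ) → 2 ≤ n → KappaNeqCKappa (PowerAdj (mulQ n))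
    dicyclic (suc (suc q)) _ = Dicyclic.κ≢cκ q
    dicyclic (suc zero) (s≤s ())
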